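{- Let $P$ and $P'$ be finite posets. If $P$ and $P'$ are both $d$-decomposable, then their series composition $P*P'$ and their parallel composition $P+P'$ are $d$-decomposable. If $P$ and $P'$ are both $c$-decomposable, then $P*P'$ and $P+P'$ are $c$-decomposable.
   Context: The series composition $P*P'$ is the disjoint union of $P$ and $P'$ with the orders of $P$ and $P'$ and additionally every element of $P$ below every element of $P'$; the parallel composition $P+P'$ is the disjoint union with no relations between elements of $P$ and of $P'$. A $k$-antichain (resp. $k$-chain) is a union of $k$ antichains (resp. $k$ disjoint chains); $d_k(P)$ (resp. $c_k(P)$) is the maximum size of a $k$-antichain (resp. $k$-chain). $P$ is $d$-decomposable if it has a partition into antichains $A_1,\dots,A_h$ ($h$ the height of $P$) with $|A_1\cup\dots\cup A_k|=d_k(P)$ for all $k$; $P$ is $c$-decomposable if it has a partition into chains $C_1,\dots,C_w$ ($w$ the width of $P$) with $|C_1\cup\dots\cup C_k|=c_k(P)$ for all $k$. -}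

module Defs where

open import Data.Nat using (ℕ; _≤_; _<ᵇ_; _+_)
open import Data.Fin using (Fin; toℕ; splitAt; _≟_)
open import Data.Fin.Subset using (Subset; _∈_; ∣_∣)
open import Data.Bool using (Bool; true; false)
open import Data.Sum using (_⊎_; inj₁; inj₂)
open import Data.Product using (Σ; Σ-syntax; ∃; ∃-syntax; _×_)
open import Data.Vec using (tabulate)
open import Relation.Nullary.Decidable using (⌊_⌋)
open import Relation.Binary.PropositionalEquality using (_≡_)

BRel : ℕ → Set
BRel n = Fin n → Fin n → Bool

record FinPoset : Set where
  field
    size    : ℕ
    le      : BRel size
    refl    : ∀ x → le x x ≡ true
    antisym : ∀ x y → le x y ≡ true → le y x ≡ true → x ≡ y
    trans   : ∀ x y z → le x y ≡ true → le y z ≡ true → le x z ≡ true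
open FinPoset public

module _ {n : ℕ} (le : BRel n) where

  IsAntichain : Subset n → Set
  IsAntichain A = ∀ x y → x ∈ A → y ∈ A → le x y ≡ true → x ≡ y

  IsChain : Subset n → Set
  IsChain C = ∀ x y → x ∈ C → y ∈ C → (le x y ≡ true) ⊎ (le y x ≡ true)

  IsKAntichain : ℕ → Subset n → Set
  IsKAntichain k S = Σ[ A ∈ (Fin k → Subset n) ]
      (∀ i → IsAntichain (A i)) × (∀ x → (x ∈ S → ∃[ i ] x ∈ A i) × (∀ i → x ∈ A i → x ∈ S))

  IsKChain : ℕ → Subset n → Set
  IsKChain k S = Σ[ C ∈ (Fin k → Subset n) ]
      (∀ i → IsChain (C i))
    × (∀ i j x → x ∈ C i → x ∈ C j → i ≡ j)
    × (∀ x → (x ∈ S → ∃[ i ] x ∈ C i) × (∀ i → x ∈ C i → x ∈ S))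

IsMaxSize : {n : ℕ} → (Subset n → Set) → ℕ → Set
IsMaxSize {n} Q m = (∃[ S ] Q S × ∣ S ∣ ≡ m) × (∀ S → Q S → ∣ S ∣ ≤ m)

block : {n h : ℕ} → (Fin n → Fin h) → Fin h → Subset n
block f i = tabulate (λ x → ⌊ f x ≟ i ⌋)

firstBlocks : {n h : ℕ} → (Fin n → Fin h) → ℕ → Subset n
firstBlocks f k = tabulate (λ x → toℕ (f x) <ᵇ k)

-- d-decomposable: height h, partition into antichains A_1..A_h with |A_1∪…∪A_k| = d_k for all k
DDecomposable : {n : ℕ} → BRel n → Set
DDecomposable {n} le = Σ[ h ∈ ℕ ] IsMaxSize (IsChain le) h ×
  Σ[ f ∈ (Fin n → Fin h) ] (∀ i → IsAntichain le (block f i))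
    × (∀ k → k ≤ h → IsMaxSize (IsKAntichain le k) ∣ firstBlocks f k ∣)

-- c-decomposable: width w, partition into chains C_1..C_w with |C_1∪…∪C_k| = c_k for all k
CDecomposable : {n : ℕ} → BRel n → Set
CDecomposable {n} le = Σ[ w ∈ ℕ ] IsMaxSize (IsAntichain le) w ×
  Σ[ f ∈ (Fin n → Fin w) ] (∀ i → IsChain le (block f i))
    × (∀ k → k ≤ w → IsMaxSize (IsKChain le k) ∣ firstBlocks f k ∣)

-- Series composition P*P' on Fin (|P| + |P'|): first |P| elements are P, rest P'.
series : (P Q : FinPoset) → BRel (size P + size Q)
series P Q x y with splitAt (size P) x | splitAt (size P) y
... | inj₁ a | inj₁ b = le P a b
... | inj₂ a | inj₂ b = le Q a b
... | inj₁ _ | inj₂ _ = true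
... | inj₂ _ | inj₁ _ = false

parallel : (P Q : FinPoset) → BRel (size P + size Q)
parallel P Q x y with splitAt (size P) x | splitAt (size P) y
... | inj₁ a | inj₁ b = le P a b
... | inj₂ a | inj₂ b = le Q a b
... | inj₁ _ | inj₂ _ = false
... | inj₂ _ | inj₁ _ = false

module Submission where

-- Antichains and chains are treated uniformly as two kinds of layer (Kind): a
-- d-decomposition partitions P into antichain layers, as many as the height,
-- a c-decomposition into chain layers, as many as the width, and the two only
-- differ in the relation between members of a layer and in the disjointness
-- required of k-chains.  In a composite of P and Q a kind of layer is either
-- Joinable (a layer may combine elements of both summands freely) or
-- Separated (every layer lies in one summand): in P*Q antichains are separated
-- and chains joinable, in P+Q the other way round.  Two general theorems then
-- give all four statements.
--  * merge-decomposable (layers separated, dual layers joinable): a k-family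
--    splits into an i-family of P and a j-family of Q with i + j = k; since the
--    layer sizes of a decomposition are non-increasing, merging the layers of
--    P and Q by decreasing size yields a decomposition of the composite.
--  * union-decomposable (layers joinable, dual layers separated): a k-family
--    restricts to k-families of P and of Q, so the unions of the t-th layers of
--    P and Q form a decomposition of the composite.

open import Defs hiding (refl; antisym; trans)
open import Data.Bool using (Bool; true; false; _∨_; not; T)
open import Data.Bool.Properties using (T-≡; ¬-not)
open import Data.Empty using (⊥; ⊥-elim)
open import Data.Fin using (Fin; zero; suc; toℕ; _↑ˡ_; _↑ʳ_; splitAt; inject≤)
open import Data.Fin.Properties as Finₚ
  using (toℕ<n; toℕ-inject≤; inject≤-injective; splitAt-↑ˡ; splitAt-↑ʳ; join-splitAt; ↑ˡ-injective; ↑ʳ-injective)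
open import Data.Fin.Subset as Subset using (Subset; _∈_; ∣_∣; Empty)
open import Data.Fin.Subset.Properties using (∣p∣≤n; ∣⊥∣≡0; ∉⊥; Empty-unique; nonempty?)
open import Data.Nat using (ℕ; zero; suc; _+_; _⊔_; _≤_; _<_; z≤n; s≤s; _<ᵇ_; _≡ᵇ_)
open import Data.Nat.Properties
open import Algebra.Properties.CommutativeSemigroup +-commutativeSemigroup using (interchange)
open import Data.Product using (Σ-syntax; ∃-syntax; _×_; _,_; proj₁; proj₂)
open import Data.Sum using (_⊎_; inj₁; inj₂; [_,_]′)
open import Data.Vec using ([]; _∷_; lookup; tabulate; _++_)
open import Data.Vec.Properties using (lookup∘tabulate; []=⇒lookup; lookup⇒[]=; lookup-++ˡ; lookup-++ʳ)
open import Function using (_∘_; Equivalence)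
open import Function.Definitions using (Injective)
open import Relation.Nullary using (¬_; yes; no)
open import Relation.Nullary.Decidable using (isYes; toWitness; fromWitness)
open import Relation.Binary.PropositionalEquality

-- Defs states membership and the order as Boolean equations b ≡ true, while
-- the library's lemmas about Boolean tests are phrased with T b.

T⇒≡true : ∀ {b} → T b → b ≡ true
T⇒≡true = Equivalence.to T-≡

≡true⇒T : ∀ {b} → b ≡ true → T b
≡true⇒T = Equivalence.from T-≡

true≢false : true ≢ false
true≢false ()

<ᵇ-true⇒< : ∀ m n → (m <ᵇ n) ≡ true → m < n
<ᵇ-true⇒< m n e = <ᵇ⇒< m n (≡true⇒T e)

<⇒<ᵇ-true : ∀ {m n} → m < n → (m <ᵇ n) ≡ true
<⇒<ᵇ-true m<n = T⇒≡true (<⇒<ᵇ m<n)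

≡ᵇ-true⇒≡ : ∀ m n → (m ≡ᵇ n) ≡ true → m ≡ n
≡ᵇ-true⇒≡ m n e = ≡ᵇ⇒≡ m n (≡true⇒T e)

<ᵇ-suc : ∀ v t → (v <ᵇ suc t) ≡ ((v <ᵇ t) ∨ (v ≡ᵇ t))
<ᵇ-suc zero    zero    = refl
<ᵇ-suc zero    (suc t) = refl
<ᵇ-suc (suc v) zero    = refl
<ᵇ-suc (suc v) (suc t) = <ᵇ-suc v t

<ᵇ-≡ᵇ-disjoint : ∀ v t → (v <ᵇ t) ≡ true → (v ≡ᵇ t) ≡ true → ⊥
<ᵇ-≡ᵇ-disjoint v t v<t v≡t = <-irrefl (≡ᵇ-true⇒≡ v t v≡t) (<ᵇ-true⇒< v t v<t)

bit : Bool → ℕ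
bit true  = 1
bit false = 0

count : ∀ {n} → (Fin n → Bool) → ℕ
count {zero}  σ = 0
count {suc n} σ = bit (σ zero) + count (σ ∘ suc)

count-cong : ∀ {n} {σ τ : Fin n → Bool} → (∀ x → σ x ≡ τ x) → count σ ≡ count τ
count-cong {zero}  σ≗τ = refl
count-cong {suc n} σ≗τ = cong₂ _+_ (cong bit (σ≗τ zero)) (count-cong (σ≗τ ∘ suc))

count-true : ∀ {n} {σ : Fin n → Bool} → (∀ x → σ x ≡ true) → count σ ≡ n
count-true {zero}          all = refl
count-true {suc n} {σ} all rewrite all zero = cong suc (count-true (all ∘ suc))

count-false : ∀ {n} {σ : Fin n → Bool} → (∀ x → σ x ≡ false) → count σ ≡ 0
count-false {zero}          none = refl
count-false {suc n} {σ} none rewrite none zero = count-false (none ∘ suc)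

count-++ : ∀ m {n} (σ : Fin (m + n) → Bool) →
           count σ ≡ count (λ a → σ (a ↑ˡ n)) + count (λ b → σ (m ↑ʳ b))
count-++ zero    σ = refl
count-++ (suc m) σ = trans (cong (bit (σ zero) +_) (count-++ m (σ ∘ suc)))
                           (sym (+-assoc (bit (σ zero)) _ _))

count-∨ : ∀ {n} (σ τ : Fin n → Bool) → (∀ x → σ x ≡ true → τ x ≡ true → ⊥) →
          count (λ x → σ x ∨ τ x) ≡ count σ + count τ
count-∨ {zero}  σ τ disj = refl
count-∨ {suc n} σ τ disj = begin
    bit (σ zero ∨ τ zero) + count (λ x → σ (suc x) ∨ τ (suc x))
      ≡⟨ cong₂ _+_ (bit-∨ (σ zero) (τ zero) (disj zero)) (count-∨ (σ ∘ suc) (τ ∘ suc) (disj ∘ suc)) ⟩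
    (bit (σ zero) + bit (τ zero)) + (count (σ ∘ suc) + count (τ ∘ suc))
      ≡⟨ interchange (bit (σ zero)) (bit (τ zero)) _ _ ⟩
    count σ + count τ ∎
  where
  open ≡-Reasoning
  bit-∨ : ∀ b c → (b ≡ true → c ≡ true → ⊥) → bit (b ∨ c) ≡ bit b + bit c
  bit-∨ true  true  excl = ⊥-elim (excl refl refl)
  bit-∨ true  false excl = refl
  bit-∨ false c     excl = refl

count-not : ∀ {n} (σ : Fin n → Bool) → count σ + count (not ∘ σ) ≡ n
count-not {zero}  σ = refl
count-not {suc n} σ = begin
    (bit (σ zero) + count (σ ∘ suc)) + (bit (not (σ zero)) + count (not ∘ σ ∘ suc))
      ≡⟨ interchange (bit (σ zero)) _ _ _ ⟩
    (bit (σ zero) + bit (not (σ zero))) + (count (σ ∘ suc) + count (not ∘ σ ∘ suc))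
      ≡⟨ cong₂ _+_ (bit-not (σ zero)) (count-not (σ ∘ suc)) ⟩
    suc n ∎
  where
  open ≡-Reasoning
  bit-not : ∀ b → bit b + bit (not b) ≡ 1
  bit-not true  = refl
  bit-not false = refl

count-below : ∀ {H} k → k ≤ H → count (λ (i : Fin H) → toℕ i <ᵇ k) ≡ k
count-below {zero}  zero    _         = refl
count-below {suc H} zero    _         = count-false {σ = λ (i : Fin (suc H)) → toℕ i <ᵇ 0} (λ _ → refl)
count-below {suc H} (suc k) (s≤s k≤H) = cong suc (count-below k k≤H)

count-at : ∀ {H} c → c < H → count (λ (i : Fin H) → toℕ i ≡ᵇ c) ≡ 1
count-at {suc H} zero    _         = cong suc (count-false {σ = λ (i : Fin H) → suc (toℕ i) ≡ᵇ 0} (λ _ → refl))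
count-at {suc H} (suc c) (s≤s c<H) = count-at c c<H

∈⇒lookup : ∀ {n} {x : Fin n} {S : Subset n} → x ∈ S → lookup S x ≡ true
∈⇒lookup = []=⇒lookup

lookup⇒∈ : ∀ {n} {x : Fin n} {S : Subset n} → lookup S x ≡ true → x ∈ S
lookup⇒∈ {x = x} {S} = lookup⇒[]= x S

∈-tabulate⁻ : ∀ {n} {x : Fin n} {σ : Fin n → Bool} → x ∈ tabulate σ → σ x ≡ true
∈-tabulate⁻ {x = x} {σ} x∈ = trans (sym (lookup∘tabulate σ x)) (∈⇒lookup x∈)

∈-tabulate⁺ : ∀ {n} {x : Fin n} {σ : Fin n → Bool} → σ x ≡ true → x ∈ tabulate σ
∈-tabulate⁺ {x = x} {σ} σx = lookup⇒∈ (trans (lookup∘tabulate σ x) σx)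

∣∣≡count : ∀ {n} (S : Subset n) → ∣ S ∣ ≡ count (lookup S)
∣∣≡count []          = refl
∣∣≡count (true ∷ S)  = cong suc (∣∣≡count S)
∣∣≡count (false ∷ S) = ∣∣≡count S

∣tabulate∣ : ∀ {n} (σ : Fin n → Bool) → ∣ tabulate σ ∣ ≡ count σ
∣tabulate∣ σ = trans (∣∣≡count (tabulate σ)) (count-cong (lookup∘tabulate σ))

∣++∣ : ∀ {m n} (S : Subset m) (S′ : Subset n) → ∣ S ++ S′ ∣ ≡ ∣ S ∣ + ∣ S′ ∣
∣++∣ []          S′ = refl
∣++∣ (true ∷ S)  S′ = cong suc (∣++∣ S S′)
∣++∣ (false ∷ S) S′ = ∣++∣ S S′

Pairwise : ∀ {n} → (Fin n → Fin n → Set) → Subset n → Set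
Pairwise C S = ∀ x y → x ∈ S → y ∈ S → C x y

Homogeneous : ∀ {n H} → (Fin n → Fin n → Set) → (Fin n → Fin H) → Set
Homogeneous C f = ∀ x y → f x ≡ f y → C x y

∈-block⁻ : ∀ {n H} {f : Fin n → Fin H} {x i} → x ∈ block f i → f x ≡ i
∈-block⁻ x∈ = toWitness (≡true⇒T (∈-tabulate⁻ x∈))

∈-block⁺ : ∀ {n H} {f : Fin n → Fin H} {x i} → f x ≡ i → x ∈ block f i
∈-block⁺ fx≡i = ∈-tabulate⁺ (T⇒≡true (fromWitness fx≡i))

homogeneous⇒blocks : ∀ {n H} {C} {f : Fin n → Fin H} → Homogeneous C f → ∀ i → Pairwise C (block f i)
homogeneous⇒blocks hom i x y x∈ y∈ = hom x y (trans (∈-block⁻ x∈) (sym (∈-block⁻ y∈)))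

blocks⇒homogeneous : ∀ {n H} {C} {f : Fin n → Fin H} → (∀ i → Pairwise C (block f i)) → Homogeneous C f
blocks⇒homogeneous {f = f} pw x y fx≡fy = pw (f x) x y (∈-block⁺ refl) (∈-block⁺ (sym fx≡fy))

record Enumeration {k} (σ : Fin k → Bool) (j : ℕ) : Set where
  field
    enum      : Fin j → Fin k
    injective : Injective _≡_ _≡_ enum
    sound     : ∀ u → σ (enum u) ≡ true
    complete  : ∀ t → σ t ≡ true → ∃[ u ] enum u ≡ t

enumerate-step : ∀ {k j} (σ : Fin (suc k) → Bool) (b : Bool) → σ zero ≡ b →
                 Enumeration (σ ∘ suc) j → Enumeration σ (bit b + j)
enumerate-step {k} {j} σ true σ₀ E =
  record { enum = enum′ ; injective = inj ; sound = snd ; complete = cmp }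
  where
  open Enumeration E
  enum′ : Fin (suc j) → Fin (suc k)
  enum′ zero    = zero
  enum′ (suc u) = suc (enum u)
  inj : Injective _≡_ _≡_ enum′
  inj {zero}  {zero}  _ = refl
  inj {suc u} {suc v} e = cong suc (injective (Finₚ.suc-injective e))
  snd : ∀ u → σ (enum′ u) ≡ true
  snd zero    = σ₀
  snd (suc u) = sound u
  cmp : ∀ t → σ t ≡ true → ∃[ u ] enum′ u ≡ t
  cmp zero    _  = zero , refl
  cmp (suc t) σt = let (u , e) = complete t σt in suc u , cong suc e
enumerate-step σ false σ₀ E =
  record { enum = suc ∘ enum ; injective = inj ; sound = sound ; complete = cmp }
  where
  open Enumeration E
  inj : Injective _≡_ _≡_ (suc ∘ enum)
  inj e = injective (Finₚ.suc-injective e)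
  cmp : ∀ t → σ t ≡ true → ∃[ u ] suc (enum u) ≡ t
  cmp zero    σt = ⊥-elim (true≢false (trans (sym σt) σ₀))
  cmp (suc t) σt = let (u , e) = complete t σt in u , cong suc e

enumerate : ∀ {k} (σ : Fin k → Bool) → Enumeration σ (count σ)
enumerate {zero}  σ = record { enum = λ () ; injective = λ {} ; sound = λ () ; complete = λ () }
enumerate {suc k} σ = enumerate-step σ (σ zero) refl (enumerate (σ ∘ suc))

Covers : ∀ {n k} → (Fin k → Subset n) → Subset n → Set
Covers A S = ∀ x → (x ∈ S → ∃[ i ] x ∈ A i) × (∀ i → x ∈ A i → x ∈ S)

Disjoint : ∀ {n k} → (Fin k → Subset n) → Set
Disjoint A = ∀ i j x → x ∈ A i → x ∈ A j → i ≡ j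

covers-blocks : ∀ {n H j} (f : Fin n → Fin H) {σ : Fin H → Bool} (E : Enumeration σ j) →
                Covers (block f ∘ Enumeration.enum E) (tabulate (σ ∘ f))
covers-blocks f {σ} E x =
    (λ x∈ → let (u , e) = complete (f x) (∈-tabulate⁻ x∈) in u , ∈-block⁺ (sym e))
  , (λ u x∈ → ∈-tabulate⁺ (subst (λ i → σ i ≡ true) (sym (∈-block⁻ x∈)) (sound u)))
  where open Enumeration E

disjoint-blocks : ∀ {n H j} (f : Fin n → Fin H) {σ : Fin H → Bool} (E : Enumeration σ j) →
                  Disjoint (block f ∘ Enumeration.enum E)
disjoint-blocks f E u v x x∈u x∈v =
  Enumeration.injective E (trans (sym (∈-block⁻ x∈u)) (∈-block⁻ x∈v))

record OrderEmbedding {m n} (le′ : BRel m) (le : BRel n) : Set where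
  field
    embed     : Fin m → Fin n
    injective : Injective _≡_ _≡_ embed
    preserves : ∀ a b → le (embed a) (embed b) ≡ le′ a b
open OrderEmbedding

restrict : ∀ {m n} → (Fin m → Fin n) → Subset n → Subset m
restrict ι S = tabulate (lookup S ∘ ι)

∈-restrict⁻ : ∀ {m n} {ι : Fin m → Fin n} {S a} → a ∈ restrict ι S → ι a ∈ S
∈-restrict⁻ a∈ = lookup⇒∈ (∈-tabulate⁻ a∈)

∈-restrict⁺ : ∀ {m n} {ι : Fin m → Fin n} {S a} → ι a ∈ S → a ∈ restrict ι S
∈-restrict⁺ ιa∈ = ∈-tabulate⁺ (∈⇒lookup ιa∈)

pairwise-restrict : ∀ {m n} {C′ : Fin m → Fin m → Set} {C : Fin n → Fin n → Set} (ι : Fin m → Fin n) →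
                    (∀ a b → C (ι a) (ι b) → C′ a b) → ∀ {S} → Pairwise C S → Pairwise C′ (restrict ι S)
pairwise-restrict ι reflect pw a b a∈ b∈ = reflect a b (pw (ι a) (ι b) (∈-restrict⁻ a∈) (∈-restrict⁻ b∈))

covers-restrict : ∀ {m n k j} (ι : Fin m → Fin n) {A : Fin k → Subset n} {S} → Covers A S →
                  (e : Fin j → Fin k) → (∀ t a → ι a ∈ A t → ∃[ u ] e u ≡ t) →
                  Covers (restrict ι ∘ A ∘ e) (restrict ι S)
covers-restrict ι {A} cov e meets a =
    (λ a∈ → let (t , ιa∈) = proj₁ (cov (ι a)) (∈-restrict⁻ a∈)
                (u , eu≡t) = meets t a ιa∈
            in u , ∈-restrict⁺ (subst (λ i → ι a ∈ A i) (sym eu≡t) ιa∈))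
  , (λ u a∈ → ∈-restrict⁺ (proj₂ (cov (ι a)) (e u) (∈-restrict⁻ a∈)))

disjoint-restrict : ∀ {m n k j} (ι : Fin m → Fin n) {A : Fin k → Subset n} → Disjoint A →
                    {e : Fin j → Fin k} → Injective _≡_ _≡_ e → Disjoint (restrict ι ∘ A ∘ e)
disjoint-restrict ι disj e-inj u v a a∈u a∈v = e-inj (disj _ _ (ι a) (∈-restrict⁻ a∈u) (∈-restrict⁻ a∈v))

NotStrictlyBelow : ∀ {n} → BRel n → Fin n → Fin n → Set
NotStrictlyBelow le x y = le x y ≡ true → x ≡ y

Comparable : ∀ {n} → BRel n → Fin n → Fin n → Set
Comparable le x y = (le x y ≡ true) ⊎ (le y x ≡ true)

module _ {m n} {le′ : BRel m} {le : BRel n} (ι : OrderEmbedding le′ le) where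

  notStrictlyBelow-preserve : ∀ {a b} → NotStrictlyBelow le′ a b → NotStrictlyBelow le (embed ι a) (embed ι b)
  notStrictlyBelow-preserve {a} {b} c le-ab = cong (embed ι) (c (trans (sym (preserves ι a b)) le-ab))

  notStrictlyBelow-reflect : ∀ a b → NotStrictlyBelow le (embed ι a) (embed ι b) → NotStrictlyBelow le′ a b
  notStrictlyBelow-reflect a b c le′-ab = injective ι (c (trans (preserves ι a b) le′-ab))

  comparable-preserve : ∀ {a b} → Comparable le′ a b → Comparable le (embed ι a) (embed ι b)
  comparable-preserve {a} {b} (inj₁ ab) = inj₁ (trans (preserves ι a b) ab)
  comparable-preserve {a} {b} (inj₂ ba) = inj₂ (trans (preserves ι b a) ba)

  comparable-reflect : ∀ a b → Comparable le (embed ι a) (embed ι b) → Comparable le′ a b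
  comparable-reflect a b (inj₁ ab) = inj₁ (trans (sym (preserves ι a b)) ab)
  comparable-reflect a b (inj₂ ba) = inj₂ (trans (sym (preserves ι b a)) ba)

-- A kind of layer (antichains, or chains) described uniformly: Compat is the
-- relation between two members of one layer, and Family le k S says that S is
-- a union of k layers.  The two fields at the end are the only places where
-- the difference between k-antichains and k-chains (disjointness) matters.
record Kind : Set₁ where
  field
    Compat : ∀ {n} → BRel n → Fin n → Fin n → Set
    Family : ∀ {n} → BRel n → ℕ → Subset n → Set
    compat-preserve : ∀ {m n} {le′ : BRel m} {le : BRel n} (ι : OrderEmbedding le′ le) {a b} →
                      Compat le′ a b → Compat le (embed ι a) (embed ι b)
    compat-reflect  : ∀ {m n} {le′ : BRel m} {le : BRel n} (ι : OrderEmbedding le′ le) a b →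
                      Compat le (embed ι a) (embed ι b) → Compat le′ a b
    layers : ∀ {n} {le : BRel n} {k S} → Family le k S → Fin k → Subset n
    layers-compatible : ∀ {n} {le : BRel n} {k S} (F : Family le k S) t → Pairwise (Compat le) (layers F t)
    family-restrict : ∀ {m n} {le′ : BRel m} {le : BRel n} (ι : OrderEmbedding le′ le) {k j S}
                      (F : Family le k S) (e : Fin j → Fin k) → Injective _≡_ _≡_ e →
                      (∀ t a → embed ι a ∈ layers F t → ∃[ u ] e u ≡ t) → Family le′ j (restrict (embed ι) S)
    family-of-blocks : ∀ {n H} {le : BRel n} (f : Fin n → Fin H) → Homogeneous (Compat le) f →
                       (σ : Fin H → Bool) → Family le (count σ) (tabulate (σ ∘ f))
open Kind

antichains : Kind
antichains = record
  { Compat = NotStrictlyBelow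
  ; Family = IsKAntichain
  ; compat-preserve = notStrictlyBelow-preserve
  ; compat-reflect = notStrictlyBelow-reflect
  ; layers = proj₁
  ; layers-compatible = λ F → proj₁ (proj₂ F)
  ; family-restrict = λ ι (A , anti , cov) e _ meets →
      restrict (embed ι) ∘ A ∘ e ,
      (λ u → pairwise-restrict (embed ι) (notStrictlyBelow-reflect ι) (anti (e u))) ,
      covers-restrict (embed ι) cov e meets
  ; family-of-blocks = λ f hom σ → let E = enumerate σ in
      block f ∘ Enumeration.enum E ,
      (λ u → homogeneous⇒blocks hom (Enumeration.enum E u)) ,
      covers-blocks f E
  }

chains : Kind
chains = record
  { Compat = Comparable
  ; Family = IsKChain
  ; compat-preserve = comparable-preserve
  ; compat-reflect = comparable-reflect
  ; layers = proj₁
  ; layers-compatible = λ F → proj₁ (proj₂ F)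
  ; family-restrict = λ ι (C , chain , disj , cov) e e-inj meets →
      restrict (embed ι) ∘ C ∘ e ,
      (λ u → pairwise-restrict (embed ι) (comparable-reflect ι) (chain (e u))) ,
      disjoint-restrict (embed ι) disj e-inj ,
      covers-restrict (embed ι) cov e meets
  ; family-of-blocks = λ f hom σ → let E = enumerate σ in
      block f ∘ Enumeration.enum E ,
      (λ u → homogeneous⇒blocks hom (Enumeration.enum E u)) ,
      disjoint-blocks f E ,
      covers-blocks f E
  }

-- Decomposability for a kind K of layers, whose number is measured by the dual
-- kind K* (antichain layers are counted by the height, chain layers by the width).
-- Unfolding the definitions, Decomposable antichains chains is DDecomposable and
-- Decomposable chains antichains is CDecomposable.
Decomposable : Kind → Kind → ∀ {n} → BRel n → Set
Decomposable K K* {n} le = Σ[ h ∈ ℕ ] IsMaxSize (Pairwise (Compat K* le)) h ×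
  Σ[ f ∈ (Fin n → Fin h) ] (∀ i → Pairwise (Compat K le) (block f i))
    × (∀ k → k ≤ h → IsMaxSize (Family K le k) ∣ firstBlocks f k ∣)

Antitone : (ℕ → ℕ) → Set
Antitone a = ∀ t → a (suc t) ≤ a t

VanishesFrom : ℕ → (ℕ → ℕ) → Set
VanishesFrom h a = ∀ t → h ≤ t → a t ≡ 0

partialSum : (ℕ → ℕ) → ℕ → ℕ
partialSum a zero    = 0
partialSum a (suc k) = a 0 + partialSum (a ∘ suc) k

partialSum-suc : ∀ a k → partialSum a (suc k) ≡ partialSum a k + a k
partialSum-suc a zero    = +-identityʳ (a 0)
partialSum-suc a (suc k) = trans (cong (a 0 +_) (partialSum-suc (a ∘ suc) k)) (sym (+-assoc (a 0) _ _))

blockSize : ∀ {n H} → (Fin n → Fin H) → ℕ → ℕ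
blockSize f t = count (λ x → toℕ (f x) ≡ᵇ t)

prefixSize : ∀ {n H} → (Fin n → Fin H) → ℕ → ℕ
prefixSize f k = count (λ x → toℕ (f x) <ᵇ k)

∣firstBlocks∣ : ∀ {n H} (f : Fin n → Fin H) k → ∣ firstBlocks f k ∣ ≡ prefixSize f k
∣firstBlocks∣ f k = ∣tabulate∣ (λ x → toℕ (f x) <ᵇ k)

prefixSize-suc : ∀ {n H} (f : Fin n → Fin H) k → prefixSize f (suc k) ≡ prefixSize f k + blockSize f k
prefixSize-suc f k = trans (count-cong (λ x → <ᵇ-suc (toℕ (f x)) k))
                           (count-∨ _ _ (λ x → <ᵇ-≡ᵇ-disjoint (toℕ (f x)) k))

prefixSize≡partialSum : ∀ {n H} (f : Fin n → Fin H) k → prefixSize f k ≡ partialSum (blockSize f) k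
prefixSize≡partialSum f zero    = count-false {σ = λ x → toℕ (f x) <ᵇ 0} (λ _ → refl)
prefixSize≡partialSum f (suc k) = begin
  prefixSize f (suc k)                          ≡⟨ prefixSize-suc f k ⟩
  prefixSize f k + blockSize f k                ≡⟨ cong (_+ blockSize f k) (prefixSize≡partialSum f k) ⟩
  partialSum (blockSize f) k + blockSize f k    ≡⟨ sym (partialSum-suc (blockSize f) k) ⟩
  partialSum (blockSize f) (suc k)              ∎
  where open ≡-Reasoning

prefixSize-inject≤ : ∀ {n H H′} (f : Fin n → Fin H) (H≤H′ : H ≤ H′) k →
                     prefixSize (λ x → inject≤ (f x) H≤H′) k ≡ prefixSize f k
prefixSize-inject≤ f H≤H′ k = count-cong (λ x → cong (_<ᵇ k) (toℕ-inject≤ (f x) H≤H′))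

blockSize-vanish : ∀ {n H} (f : Fin n → Fin H) → VanishesFrom H (blockSize f)
blockSize-vanish f t H≤t = count-false λ x → ¬-not (λ e →
  <-irrefl (≡ᵇ-true⇒≡ (toℕ (f x)) t e) (<-≤-trans (toℕ<n (f x)) H≤t))

prefixSize-full : ∀ {n H} (f : Fin n → Fin H) k → H ≤ k → prefixSize f k ≡ n
prefixSize-full f k H≤k = count-true (λ x → <⇒<ᵇ-true (<-≤-trans (toℕ<n (f x)) H≤k))

module _ (K : Kind) {n} {le : BRel n} where

  firstBlocks-family : ∀ {H} (f : Fin n → Fin H) → Homogeneous (Compat K le) f →
                       ∀ k → k ≤ H → Family K le k (firstBlocks f k)
  firstBlocks-family f hom k k≤H =
    subst (λ j → Family K le j (firstBlocks f k)) (count-below k k≤H)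
          (family-of-blocks K f hom (λ i → toℕ i <ᵇ k))

  -- If the first k blocks are a largest k-family for every k ≤ H, block sizes are
  -- non-increasing: blocks 0, …, t-1 together with block t+1 form a (t+1)-family,
  -- so they are no larger than blocks 0, …, t.
  blockSize-antitone : ∀ {H} (f : Fin n → Fin H) → Homogeneous (Compat K le) f →
                       (∀ k → k ≤ H → ∀ S → Family K le k S → ∣ S ∣ ≤ prefixSize f k) →
                       Antitone (blockSize f)
  blockSize-antitone {H} f hom largest t with suc (suc t) ≤? H
  ... | no  t+2≰H = ≤-trans (≤-reflexive (blockSize-vanish f (suc t) (≤-pred (≰⇒> t+2≰H)))) z≤n
  ... | yes t+2≤H = +-cancelˡ-≤ (prefixSize f t) _ _ (begin
      prefixSize f t + blockSize f (suc t) ≡⟨ count-∨ _ _ (λ x → skip-disjoint (toℕ (f x))) ⟨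
      count (σ ∘ f)                        ≡⟨ ∣tabulate∣ (σ ∘ f) ⟨
      ∣ tabulate (σ ∘ f) ∣                 ≤⟨ largest (suc t) (≤-trans (n≤1+n (suc t)) t+2≤H) _ family ⟩
      prefixSize f (suc t)                 ≡⟨ prefixSize-suc f t ⟩
      prefixSize f t + blockSize f t       ∎)
    where
    open ≤-Reasoning
    below-t at-t+1 σ : Fin H → Bool
    below-t i = toℕ i <ᵇ t
    at-t+1  i = toℕ i ≡ᵇ suc t
    σ i = below-t i ∨ at-t+1 i
    skip-disjoint : ∀ v → (v <ᵇ t) ≡ true → (v ≡ᵇ suc t) ≡ true → ⊥
    skip-disjoint v v<t = <ᵇ-≡ᵇ-disjoint v (suc t) (<⇒<ᵇ-true (m<n⇒m<1+n (<ᵇ-true⇒< v t v<t)))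
    count-σ : count σ ≡ suc t
    count-σ = begin-equality
      count σ                       ≡⟨ count-∨ below-t at-t+1 (λ i → skip-disjoint (toℕ i)) ⟩
      count below-t + count at-t+1
        ≡⟨ cong₂ _+_ (count-below t (≤-trans (m≤n+m t 2) t+2≤H))
                     (count-at (suc t) t+2≤H) ⟩
      t + 1                         ≡⟨ +-comm t 1 ⟩
      suc t                         ∎
    family : Family K le (suc t) (tabulate (σ ∘ f))
    family = subst (λ j → Family K le j (tabulate (σ ∘ f))) count-σ (family-of-blocks K f hom σ)

  assemble : ∀ {K*} H → IsMaxSize (Pairwise (Compat K* le)) H → (f : Fin n → Fin H) →
             Homogeneous (Compat K le) f →
             (∀ k → k ≤ H → ∀ S → Family K le k S → ∣ S ∣ ≤ prefixSize f k) →
             Decomposable K K* le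
  assemble H H-max f hom largest = H , H-max , f , homogeneous⇒blocks hom ,
    λ k k≤H → (firstBlocks f k , firstBlocks-family f hom k k≤H , refl) ,
              λ S F → subst (∣ S ∣ ≤_) (sym (∣firstBlocks∣ f k)) (largest k k≤H S F)

record Profile (K K* : Kind) {n} (le : BRel n) : Set where
  field
    length      : ℕ
    length-max  : IsMaxSize (Pairwise (Compat K* le)) length
    layer       : Fin n → Fin length
    homogeneous : Homogeneous (Compat K le) layer
    largest     : ∀ k S → Family K le k S → ∣ S ∣ ≤ prefixSize layer k
    antitone    : Antitone (blockSize layer)

profile : ∀ K K* {n} {le : BRel n} → Decomposable K K* le → Profile K K* le
profile K K* {n} {le} (h , h-max , f , blocks , firstBlocks-max) = record
  { length = h ; length-max = h-max ; layer = f ; homogeneous = hom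
  ; largest = largest ; antitone = blockSize-antitone K f hom (λ k k≤h → largest k) }
  where
  hom : Homogeneous (Compat K le) f
  hom = blocks⇒homogeneous blocks
  largest : ∀ k S → Family K le k S → ∣ S ∣ ≤ prefixSize f k
  largest k S F with k ≤? h
  ... | yes k≤h = subst (∣ S ∣ ≤_) (∣firstBlocks∣ f k) (proj₂ (firstBlocks-max k k≤h) S F)
  ... | no  k≰h = subst (∣ S ∣ ≤_) (sym (prefixSize-full f k (<⇒≤ (≰⇒> k≰h)))) (∣p∣≤n S)

-- Layer sizes are a (positions 0 … h-1) and
-- b (positions 0 … h′-1); left and right give their positions in a merged
-- sequence of length N.
record BestSplit (a b : ℕ → ℕ) {h h′ N} (left : Fin h → Fin N) (right : Fin h′ → Fin N) (k : ℕ) : Set where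
  field
    p q          : ℕ
    p+q≡k        : p + q ≡ k
    left-prefix  : ∀ i → (toℕ (left i) <ᵇ k) ≡ (toℕ i <ᵇ p)
    right-prefix : ∀ j → (toℕ (right j) <ᵇ k) ≡ (toℕ j <ᵇ q)
    optimal      : ∀ i j → i + j ≡ k → partialSum a i + partialSum b j ≤ partialSum a p + partialSum b q

record Interleaving (a b : ℕ → ℕ) (h h′ N : ℕ) : Set where
  field
    left            : Fin h → Fin N
    right           : Fin h′ → Fin N
    left-injective  : Injective _≡_ _≡_ left
    right-injective : Injective _≡_ _≡_ right
    left≢right      : ∀ i j → left i ≢ right j
    best            : ∀ k → k ≤ N → BestSplit a b left right k

module _ {a b : ℕ → ℕ} {h h′ N} {left : Fin h → Fin N} {right : Fin h′ → Fin N} where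

  bestSplit-zero : BestSplit a b left right 0
  bestSplit-zero = record
    { p = 0 ; q = 0 ; p+q≡k = refl ; left-prefix = λ _ → refl ; right-prefix = λ _ → refl
    ; optimal = λ { zero zero _ → z≤n } }

  bestSplit-swap : ∀ {k} → BestSplit a b left right k → BestSplit b a right left k
  bestSplit-swap S = record
    { p = q ; q = p ; p+q≡k = trans (+-comm q p) p+q≡k
    ; left-prefix = right-prefix ; right-prefix = left-prefix
    ; optimal = λ i j i+j≡k → subst₂ _≤_ (+-comm (partialSum a j) _) (+-comm (partialSum a p) _)
                                      (optimal j i (trans (+-comm j i) i+j≡k)) }
    where open BestSplit S

interleaving-swap : ∀ {a b h h′ N} → Interleaving a b h h′ N → Interleaving b a h′ h N
interleaving-swap I = record
  { left = right ; right = left ; left-injective = right-injective ; right-injective = left-injective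
  ; left≢right = λ i j e → left≢right j i (sym e)
  ; best = λ k k≤N → bestSplit-swap (best k k≤N) }
  where open Interleaving I

module _ {a b : ℕ → ℕ} {h h′ N} (I : Interleaving (a ∘ suc) b h h′ N) (a₀-largest : ∀ t → b t ≤ a 0) where
  open Interleaving I
  private
    left₊ : Fin (suc h) → Fin (suc N)
    left₊ zero    = zero
    left₊ (suc i) = suc (left i)

    left₊-injective : Injective _≡_ _≡_ left₊
    left₊-injective {zero}  {zero}  _ = refl
    left₊-injective {suc i} {suc j} e = cong suc (left-injective (Finₚ.suc-injective e))

    left₊≢right₊ : ∀ i j → left₊ i ≢ suc (right j)
    left₊≢right₊ (suc i) j e = left≢right i j (Finₚ.suc-injective e)

    best₊ : ∀ k → k ≤ suc N → BestSplit a b left₊ (suc ∘ right) k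
    best₊ zero    _         = bestSplit-zero
    best₊ (suc k) (s≤s k≤N) = record
      { p = suc p ; q = q ; p+q≡k = cong suc p+q≡k
      ; left-prefix = λ { zero → refl ; (suc i) → left-prefix i }
      ; right-prefix = right-prefix ; optimal = optimal₊ }
      where
      open BestSplit (best k k≤N)
      open ≤-Reasoning
      optimal₊ : ∀ i j → i + j ≡ suc k → partialSum a i + partialSum b j ≤ partialSum a (suc p) + partialSum b q
      optimal₊ (suc i) j i+j≡k = begin
        (a 0 + partialSum (a ∘ suc) i) + partialSum b j ≡⟨ +-assoc (a 0) _ _ ⟩
        a 0 + (partialSum (a ∘ suc) i + partialSum b j) ≤⟨ +-monoʳ-≤ (a 0) (optimal i j (suc-injective i+j≡k)) ⟩
        a 0 + (partialSum (a ∘ suc) p + partialSum b q) ≡⟨ +-assoc (a 0) _ _ ⟨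
        (a 0 + partialSum (a ∘ suc) p) + partialSum b q ∎
      optimal₊ zero .(suc k) refl = begin
        partialSum b (suc k)                            ≡⟨ partialSum-suc b k ⟩
        partialSum b k + b k                            ≤⟨ +-mono-≤ (optimal 0 k refl) (a₀-largest k) ⟩
        (partialSum (a ∘ suc) p + partialSum b q) + a 0 ≡⟨ +-comm _ (a 0) ⟩
        a 0 + (partialSum (a ∘ suc) p + partialSum b q) ≡⟨ +-assoc (a 0) _ _ ⟨
        (a 0 + partialSum (a ∘ suc) p) + partialSum b q ∎

  interleaving-consˡ : Interleaving a b (suc h) h′ (suc N)
  interleaving-consˡ = record
    { left = left₊ ; right = suc ∘ right ; left-injective = left₊-injective
    ; right-injective = λ e → right-injective (Finₚ.suc-injective e)
    ; left≢right = left₊≢right₊ ; best = best₊ }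

interleaving-consʳ : ∀ {a b h h′ N} → Interleaving a (b ∘ suc) h h′ N → (∀ t → a t ≤ b 0) →
                     Interleaving a b h (suc h′) (suc N)
interleaving-consʳ {b = b} I b₀-largest =
  interleaving-swap (interleaving-consˡ {a = b} (interleaving-swap I) b₀-largest)

antitone⇒≤first : ∀ {a} → Antitone a → ∀ t → a t ≤ a 0
antitone⇒≤first a↓ zero    = ≤-refl
antitone⇒≤first a↓ (suc t) = ≤-trans (a↓ t) (antitone⇒≤first a↓ t)

vanishes-suc : ∀ {h a} → VanishesFrom (suc h) a → VanishesFrom h (a ∘ suc)
vanishes-suc a≡0 t h≤t = a≡0 (suc t) (s≤s h≤t)

-- Two non-increasing size sequences can be merged greedily: always take the
-- larger of the two front layers next.
interleave : ∀ (a b : ℕ → ℕ) h h′ → Antitone a → Antitone b → VanishesFrom h a → VanishesFrom h′ b →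
             Interleaving a b h h′ (h + h′)
interleave a b zero zero a↓ b↓ a≡0 b≡0 = record
  { left = λ () ; right = λ () ; left-injective = λ {} ; right-injective = λ {}
  ; left≢right = λ () ; best = λ { zero _ → bestSplit-zero } }
interleave a b zero (suc h′) a↓ b↓ a≡0 b≡0 =
  interleaving-consʳ (interleave a (b ∘ suc) zero h′ a↓ (b↓ ∘ suc) a≡0 (vanishes-suc b≡0))
                     (λ t → ≤-trans (≤-reflexive (a≡0 t z≤n)) z≤n)
interleave a b (suc h) zero a↓ b↓ a≡0 b≡0 =
  interleaving-consˡ (interleave (a ∘ suc) b h zero (a↓ ∘ suc) b↓ (vanishes-suc a≡0) b≡0)
                     (λ t → ≤-trans (≤-reflexive (b≡0 t z≤n)) z≤n)
interleave a b (suc h) (suc h′) a↓ b↓ a≡0 b≡0 with b 0 ≤? a 0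
... | yes b₀≤a₀ =
  interleaving-consˡ (interleave (a ∘ suc) b h (suc h′) (a↓ ∘ suc) b↓ (vanishes-suc a≡0) b≡0)
                     (λ t → ≤-trans (antitone⇒≤first b↓ t) b₀≤a₀)
... | no  b₀≰a₀ =
  subst (Interleaving a b (suc h) (suc h′)) (cong suc (sym (+-suc h h′)))
    (interleaving-consʳ (interleave a (b ∘ suc) (suc h) h′ a↓ (b↓ ∘ suc) a≡0 (vanishes-suc b≡0))
                        (λ t → ≤-trans (antitone⇒≤first a↓ t) (<⇒≤ (≰⇒> b₀≰a₀))))

-- A composition of P and Q: an order on Fin (|P| + |Q|) that restricts to P on
-- the first summand and to Q on the second (series and parallel composition
-- differ only between the summands).
module Composite (P Q : FinPoset) (le⋆ : BRel (size P + size Q))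
    (left-order  : ∀ a b → le⋆ (a ↑ˡ size Q) (b ↑ˡ size Q) ≡ le P a b)
    (right-order : ∀ a b → le⋆ (size P ↑ʳ a) (size P ↑ʳ b) ≡ le Q a b) where

  private
    m m′ : ℕ
    m  = size P
    m′ = size Q

  L : OrderEmbedding (le P) le⋆
  L = record { embed = _↑ˡ m′ ; injective = ↑ˡ-injective m′ _ _ ; preserves = left-order }

  R : OrderEmbedding (le Q) le⋆
  R = record { embed = m ↑ʳ_ ; injective = ↑ʳ-injective m _ _ ; preserves = right-order }

  partP : Subset (m + m′) → Subset m
  partP = restrict (embed L)

  partQ : Subset (m + m′) → Subset m′
  partQ = restrict (embed R)

  data Side : Fin (m + m′) → Set where
    in-left  : ∀ a → Side (a ↑ˡ m′)
    in-right : ∀ b → Side (m ↑ʳ b)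

  side : ∀ x → Side x
  side x with splitAt m x | join-splitAt m m′ x
  ... | inj₁ a | refl = in-left a
  ... | inj₂ b | refl = in-right b

  ↑ˡ≢↑ʳ : ∀ a b → a ↑ˡ m′ ≢ m ↑ʳ b
  ↑ˡ≢↑ʳ a b e with trans (sym (splitAt-↑ˡ m a m′)) (trans (cong (splitAt m) e) (splitAt-↑ʳ m m′ b))
  ... | ()

  by-sides : {Rel : Fin (m + m′) → Fin (m + m′) → Set} →
             (∀ a a′ → Rel (a ↑ˡ m′) (a′ ↑ˡ m′)) → (∀ b b′ → Rel (m ↑ʳ b) (m ↑ʳ b′)) →
             (∀ a b → Rel (a ↑ˡ m′) (m ↑ʳ b) × Rel (m ↑ʳ b) (a ↑ˡ m′)) → ∀ x y → Rel x y
  by-sides ll rr lr x y with side x | side y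
  ... | in-left a  | in-left a′  = ll a a′
  ... | in-right b | in-right b′ = rr b b′
  ... | in-left a  | in-right b  = proj₁ (lr a b)
  ... | in-right b | in-left a   = proj₂ (lr a b)

  _⊕_ : ∀ {A : Set} → (Fin m → A) → (Fin m′ → A) → Fin (m + m′) → A
  (g ⊕ g′) x = [ g , g′ ]′ (splitAt m x)

  ⊕-left : ∀ {A : Set} (g : Fin m → A) (g′ : Fin m′ → A) a → (g ⊕ g′) (a ↑ˡ m′) ≡ g a
  ⊕-left g g′ a rewrite splitAt-↑ˡ m a m′ = refl

  ⊕-right : ∀ {A : Set} (g : Fin m → A) (g′ : Fin m′ → A) b → (g ⊕ g′) (m ↑ʳ b) ≡ g′ b
  ⊕-right g g′ b rewrite splitAt-↑ʳ m m′ b = refl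

  prefixSize-⊕ : ∀ {H} (g : Fin m → Fin H) (g′ : Fin m′ → Fin H) k →
                 prefixSize (g ⊕ g′) k ≡ prefixSize g k + prefixSize g′ k
  prefixSize-⊕ g g′ k = trans (count-++ m _)
    (cong₂ _+_ (count-cong (λ a → cong (λ i → toℕ i <ᵇ k) (⊕-left g g′ a)))
               (count-cong (λ b → cong (λ i → toℕ i <ᵇ k) (⊕-right g g′ b))))

  ∣∣-split : ∀ S → ∣ S ∣ ≡ ∣ partP S ∣ + ∣ partQ S ∣
  ∣∣-split S = begin
    ∣ S ∣                                                    ≡⟨ ∣∣≡count S ⟩
    count (lookup S)                                         ≡⟨ count-++ m (lookup S) ⟩
    count (lookup S ∘ embed L) + count (lookup S ∘ embed R)
      ≡⟨ cong₂ _+_ (∣tabulate∣ (lookup S ∘ embed L)) (∣tabulate∣ (lookup S ∘ embed R)) ⟨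
    ∣ partP S ∣ + ∣ partQ S ∣                                ∎
    where open ≡-Reasoning

  ∈-++ˡ : ∀ {S : Subset m} {S′ : Subset m′} {a} → a ↑ˡ m′ ∈ S ++ S′ → a ∈ S
  ∈-++ˡ {S} {S′} {a} a∈ = lookup⇒∈ (trans (sym (lookup-++ˡ S S′ a)) (∈⇒lookup a∈))

  ∈-++ʳ : ∀ {S : Subset m} {S′ : Subset m′} {b} → m ↑ʳ b ∈ S ++ S′ → b ∈ S′
  ∈-++ʳ {S} {S′} {b} b∈ = lookup⇒∈ (trans (sym (lookup-++ʳ S S′ b)) (∈⇒lookup b∈))

  ∣empty∣ : ∀ {k} {S : Subset k} → Empty S → ∣ S ∣ ≡ 0
  ∣empty∣ {k} e = trans (cong ∣_∣ (Empty-unique e)) (∣⊥∣≡0 k)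

  module _ (K : Kind) where
    private
      C⋆ = Compat K le⋆
      CP = Compat K (le P)
      CQ = Compat K (le Q)

    Linked : Fin (m + m′) → Fin (m + m′) → Set
    Linked x y = C⋆ x y × C⋆ y x

    Joinable Separated : Set
    Joinable  = ∀ a b → Linked (embed L a) (embed R b)
    Separated = ∀ a b → ¬ Linked (embed L a) (embed R b)

    pairwise-++ : ∀ {S S′} → Pairwise CP S → Pairwise CQ S′ →
                  (∀ a b → a ∈ S → b ∈ S′ → Linked (embed L a) (embed R b)) → Pairwise C⋆ (S ++ S′)
    pairwise-++ pw pw′ link = by-sides
      (λ a a′ a∈ a′∈ → compat-preserve K L (pw a a′ (∈-++ˡ a∈) (∈-++ˡ a′∈)))
      (λ b b′ b∈ b′∈ → compat-preserve K R (pw′ b b′ (∈-++ʳ b∈) (∈-++ʳ b′∈)))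
      (λ a b → (λ a∈ b∈ → proj₁ (link a b (∈-++ˡ a∈) (∈-++ʳ b∈)))
             , (λ b∈ a∈ → proj₂ (link a b (∈-++ˡ a∈) (∈-++ʳ b∈))))

    homogeneous-⊕ : ∀ {H} {g : Fin m → Fin H} {g′ : Fin m′ → Fin H} →
                    Homogeneous CP g → Homogeneous CQ g′ →
                    (∀ a b → g a ≡ g′ b → Linked (embed L a) (embed R b)) → Homogeneous C⋆ (g ⊕ g′)
    homogeneous-⊕ {g = g} {g′} hom hom′ link = by-sides
      (λ a a′ e → compat-preserve K L (hom a a′ (trans (sym (⊕-left g g′ a)) (trans e (⊕-left g g′ a′)))))
      (λ b b′ e → compat-preserve K R (hom′ b b′ (trans (sym (⊕-right g g′ b)) (trans e (⊕-right g g′ b′)))))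
      (λ a b → (λ e → proj₁ (link a b (glue a b e))) , (λ e → proj₂ (link a b (glue a b (sym e)))))
      where
      glue : ∀ a b → (g ⊕ g′) (a ↑ˡ m′) ≡ (g ⊕ g′) (m ↑ʳ b) → g a ≡ g′ b
      glue a b e = trans (sym (⊕-left g g′ a)) (trans e (⊕-right g g′ b))

    pairwise-sides : ∀ {S} → Pairwise C⋆ S → Pairwise CP (partP S) × Pairwise CQ (partQ S)
    pairwise-sides pw = pairwise-restrict (embed L) (compat-reflect K L) pw
                      , pairwise-restrict (embed R) (compat-reflect K R) pw

    family-sides : ∀ {k S} → Family K le⋆ k S →
                   Family K (le P) k (partP S) × Family K (le Q) k (partQ S)
    family-sides F = family-restrict K L F (λ t → t) (λ e → e) (λ t _ _ → t , refl)
                   , family-restrict K R F (λ t → t) (λ e → e) (λ t _ _ → t , refl)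

    length-sum : Joinable → ∀ {h h′} → IsMaxSize (Pairwise CP) h → IsMaxSize (Pairwise CQ) h′ →
                 IsMaxSize (Pairwise C⋆) (h + h′)
    length-sum join ((S , pw , ∣S∣≡h) , max) ((S′ , pw′ , ∣S′∣≡h′) , max′) =
        (S ++ S′ , pairwise-++ pw pw′ (λ a b _ _ → join a b) ,
         trans (∣++∣ S S′) (cong₂ _+_ ∣S∣≡h ∣S′∣≡h′))
      , λ T pwT → let (pwL , pwR) = pairwise-sides pwT in
          subst (_≤ _) (sym (∣∣-split T)) (+-mono-≤ (max _ pwL) (max′ _ pwR))

    one-sided : Separated → ∀ {S} → Pairwise C⋆ S →
                Empty (partP S) ⊎ Empty (partQ S)
    one-sided sep {S} pw with nonempty? (partP S)
    ... | no  emptyL       = inj₁ emptyL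
    ... | yes (a , a∈)     = inj₂ λ (b , b∈) →
          sep a b (pw _ _ (∈-restrict⁻ a∈) (∈-restrict⁻ b∈) , pw _ _ (∈-restrict⁻ b∈) (∈-restrict⁻ a∈))

    length-max : Separated → ∀ {h h′} → IsMaxSize (Pairwise CP) h → IsMaxSize (Pairwise CQ) h′ →
                 IsMaxSize (Pairwise C⋆) (h ⊔ h′)
    length-max sep {h} {h′} ((S , pw , ∣S∣≡h) , max) ((S′ , pw′ , ∣S′∣≡h′) , max′) = witness , bound
      where
      witness : ∃[ T ] Pairwise C⋆ T × ∣ T ∣ ≡ h ⊔ h′
      witness with h′ ≤? h
      ... | yes h′≤h = S ++ Subset.⊥ {m′} ,
                       pairwise-++ pw (λ x y x∈ → ⊥-elim (∉⊥ x∈)) (λ a b _ b∈ → ⊥-elim (∉⊥ b∈)) ,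
                       trans (∣++∣ S (Subset.⊥ {m′})) (trans (cong₂ _+_ ∣S∣≡h (∣⊥∣≡0 m′))
                             (trans (+-identityʳ h) (sym (m≥n⇒m⊔n≡m h′≤h))))
      ... | no  h′≰h = Subset.⊥ {m} ++ S′ ,
                       pairwise-++ (λ x y x∈ → ⊥-elim (∉⊥ x∈)) pw′ (λ a b a∈ _ → ⊥-elim (∉⊥ a∈)) ,
                       trans (∣++∣ (Subset.⊥ {m}) S′) (trans (cong₂ _+_ (∣⊥∣≡0 m) ∣S′∣≡h′)
                             (sym (m≤n⇒m⊔n≡n (<⇒≤ (≰⇒> h′≰h)))))
      bound : ∀ T → Pairwise C⋆ T → ∣ T ∣ ≤ h ⊔ h′
      bound T pwT with pairwise-sides pwT | one-sided sep pwT
      ... | pwL , pwR | inj₁ emptyL = begin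
        ∣ T ∣                      ≡⟨ ∣∣-split T ⟩
        ∣ partP T ∣ + ∣ partQ T ∣  ≡⟨ cong (_+ ∣ partQ T ∣) (∣empty∣ emptyL) ⟩
        ∣ partQ T ∣                ≤⟨ max′ _ pwR ⟩
        h′                         ≤⟨ m≤n⊔m h h′ ⟩
        h ⊔ h′                     ∎
        where open ≤-Reasoning
      ... | pwL , pwR | inj₂ emptyR = begin
        ∣ T ∣                      ≡⟨ ∣∣-split T ⟩
        ∣ partP T ∣ + ∣ partQ T ∣  ≡⟨ cong (∣ partP T ∣ +_) (∣empty∣ emptyR) ⟩
        ∣ partP T ∣ + 0            ≡⟨ +-identityʳ ∣ partP T ∣ ⟩
        ∣ partP T ∣                ≤⟨ max _ pwL ⟩
        h                          ≤⟨ m≤m⊔n h h′ ⟩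
        h ⊔ h′                     ∎
        where open ≤-Reasoning

    -- If layers are separated, a k-family of the composite splits into an
    -- i-family of P and a j-family of Q with i + j = k: sort its layers by the
    -- summand they lie in.
    family-split : Separated → ∀ {k S} → Family K le⋆ k S →
                   Σ[ i ∈ ℕ ] Σ[ j ∈ ℕ ] (i + j ≡ k)
                     × Family K (le P) i (partP S) × Family K (le Q) j (partQ S)
    family-split sep {k} F =
        count onLeft , count (not ∘ onLeft) , count-not onLeft
      , family-restrict K L F (enum EL) (injective EL) (λ t a a∈ → complete EL t (onLeft-intro a∈))
      , family-restrict K R F (enum ER) (injective ER) (λ t b b∈ → complete ER t (onRight b∈))
      where
      open Enumeration
      onLeft : Fin k → Bool
      onLeft t = isYes (nonempty? (partP (layers K F t)))
      onLeft-intro : ∀ {t a} → embed L a ∈ layers K F t → onLeft t ≡ true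
      onLeft-intro {t} {a} a∈ = T⇒≡true (fromWitness {a? = nonempty? (partP (layers K F t))} (a , ∈-restrict⁺ a∈))
      onRight : ∀ {t b} → embed R b ∈ layers K F t → not (onLeft t) ≡ true
      onRight {t} {b} b∈ = cong not (¬-not λ meets →
        let (a , a∈) = toWitness {a? = nonempty? (partP (layers K F t))} (≡true⇒T meets)
            pw = layers-compatible K F t
        in sep a b (pw _ _ (∈-restrict⁻ a∈) b∈ , pw _ _ b∈ (∈-restrict⁻ a∈)))
      EL = enumerate onLeft
      ER = enumerate (not ∘ onLeft)

  -- Separated layers, joinable dual layers: the composite has as many layers as
  -- P and Q together, and its layers are those of P and Q merged by size.
  merge-decomposable : ∀ K K* → Separated K → Joinable K* →
                       Decomposable K K* (le P) → Decomposable K K* (le Q) → Decomposable K K* le⋆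
  merge-decomposable K K* sep join dP dQ =
    assemble K {K* = K*} (P′.length + Q′.length) (length-sum K* join P′.length-max Q′.length-max)
             layer hom largest
    where
    module P′ = Profile (profile K K* dP)
    module Q′ = Profile (profile K K* dQ)
    a b : ℕ → ℕ
    a = blockSize P′.layer
    b = blockSize Q′.layer
    open Interleaving (interleave a b P′.length Q′.length P′.antitone Q′.antitone
                                  (blockSize-vanish P′.layer) (blockSize-vanish Q′.layer))
    layer : Fin (m + m′) → Fin (P′.length + Q′.length)
    layer = (left ∘ P′.layer) ⊕ (right ∘ Q′.layer)
    hom : Homogeneous (Compat K le⋆) layer
    hom = homogeneous-⊕ K (λ x y e → P′.homogeneous x y (left-injective e))
                          (λ x y e → Q′.homogeneous x y (right-injective e))
                          (λ x y e → ⊥-elim (left≢right _ _ e))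
    largest : ∀ k → k ≤ P′.length + Q′.length → ∀ S → Family K le⋆ k S → ∣ S ∣ ≤ prefixSize layer k
    largest k k≤ S F with family-split K sep F
    ... | i , j , i+j≡k , FL , FR = begin
      ∣ S ∣                                               ≡⟨ ∣∣-split S ⟩
      ∣ partP S ∣ + ∣ partQ S ∣                           ≤⟨ +-mono-≤ (P′.largest i _ FL) (Q′.largest j _ FR) ⟩
      prefixSize P′.layer i + prefixSize Q′.layer j       ≡⟨ cong₂ _+_ (prefixSize≡partialSum P′.layer i)
                                                                       (prefixSize≡partialSum Q′.layer j) ⟩
      partialSum a i + partialSum b j                     ≤⟨ optimal i j i+j≡k ⟩
      partialSum a p + partialSum b q                     ≡⟨ cong₂ _+_ (prefixSize≡partialSum P′.layer p)
                                                                       (prefixSize≡partialSum Q′.layer q) ⟨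
      prefixSize P′.layer p + prefixSize Q′.layer q       ≡⟨ cong₂ _+_ (count-cong (left-prefix ∘ P′.layer))
                                                                       (count-cong (right-prefix ∘ Q′.layer)) ⟨
      prefixSize (left ∘ P′.layer) k + prefixSize (right ∘ Q′.layer) k
                                                          ≡⟨ prefixSize-⊕ _ _ k ⟨
      prefixSize layer k                                  ∎
      where
      open BestSplit (best k k≤)
      open ≤-Reasoning

  -- Joinable layers, separated dual layers: the composite has as many layers as
  -- the longer of P and Q, and its t-th layer is the union of the t-th layers.
  union-decomposable : ∀ K K* → Joinable K → Separated K* →
                       Decomposable K K* (le P) → Decomposable K K* (le Q) → Decomposable K K* le⋆
  union-decomposable K K* join sep dP dQ =
    assemble K {K* = K*} (P′.length ⊔ Q′.length) (length-max K* sep P′.length-max Q′.length-max)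
             layer hom largest
    where
    module P′ = Profile (profile K K* dP)
    module Q′ = Profile (profile K K* dQ)
    P≤ = m≤m⊔n P′.length Q′.length
    Q≤ = m≤n⊔m P′.length Q′.length
    layer : Fin (m + m′) → Fin (P′.length ⊔ Q′.length)
    layer = (λ a → inject≤ (P′.layer a) P≤) ⊕ (λ b → inject≤ (Q′.layer b) Q≤)
    hom : Homogeneous (Compat K le⋆) layer
    hom = homogeneous-⊕ K (λ x y e → P′.homogeneous x y (inject≤-injective P≤ P≤ (P′.layer x) (P′.layer y) e))
                          (λ x y e → Q′.homogeneous x y (inject≤-injective Q≤ Q≤ (Q′.layer x) (Q′.layer y) e))
                          (λ x y _ → join x y)
    largest : ∀ k → k ≤ P′.length ⊔ Q′.length → ∀ S → Family K le⋆ k S → ∣ S ∣ ≤ prefixSize layer k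
    largest k _ S F = begin
      ∣ S ∣                                               ≡⟨ ∣∣-split S ⟩
      ∣ partP S ∣ + ∣ partQ S ∣                           ≤⟨ +-mono-≤ (P′.largest k _ FL) (Q′.largest k _ FR) ⟩
      prefixSize P′.layer k + prefixSize Q′.layer k       ≡⟨ cong₂ _+_ (prefixSize-inject≤ P′.layer P≤ k)
                                                                       (prefixSize-inject≤ Q′.layer Q≤ k) ⟨
      prefixSize (λ a → inject≤ (P′.layer a) P≤) k + prefixSize (λ b → inject≤ (Q′.layer b) Q≤) k
                                                          ≡⟨ prefixSize-⊕ _ _ k ⟨
      prefixSize layer k                                  ∎
      where
      open ≤-Reasoning
      FL = proj₁ (family-sides K F)
      FR = proj₂ (family-sides K F)

module _ (P Q : FinPoset) where
  private
    m m′ : ℕ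
    m  = size P
    m′ = size Q

  series-left : ∀ a b → series P Q (a ↑ˡ m′) (b ↑ˡ m′) ≡ le P a b
  series-left a b rewrite splitAt-↑ˡ m a m′ | splitAt-↑ˡ m b m′ = refl

  series-right : ∀ a b → series P Q (m ↑ʳ a) (m ↑ʳ b) ≡ le Q a b
  series-right a b rewrite splitAt-↑ʳ m m′ a | splitAt-↑ʳ m m′ b = refl

  series-below : ∀ a b → series P Q (a ↑ˡ m′) (m ↑ʳ b) ≡ true
  series-below a b rewrite splitAt-↑ˡ m a m′ | splitAt-↑ʳ m m′ b = refl

  parallel-left : ∀ a b → parallel P Q (a ↑ˡ m′) (b ↑ˡ m′) ≡ le P a b
  parallel-left a b rewrite splitAt-↑ˡ m a m′ | splitAt-↑ˡ m b m′ = refl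

  parallel-right : ∀ a b → parallel P Q (m ↑ʳ a) (m ↑ʳ b) ≡ le Q a b
  parallel-right a b rewrite splitAt-↑ʳ m m′ a | splitAt-↑ʳ m m′ b = refl

  parallel-apart : ∀ a b → (parallel P Q (a ↑ˡ m′) (m ↑ʳ b) ≡ false)
                         × (parallel P Q (m ↑ʳ b) (a ↑ˡ m′) ≡ false)
  parallel-apart a b rewrite splitAt-↑ˡ m a m′ | splitAt-↑ʳ m m′ b = refl , refl

  module Series   = Composite P Q (series P Q) series-left series-right
  module Parallel = Composite P Q (parallel P Q) parallel-left parallel-right

  series-antichains-separated : Series.Separated antichains
  series-antichains-separated a b (onlyEqualBelow , _) = Series.↑ˡ≢↑ʳ a b (onlyEqualBelow (series-below a b))

  series-chains-joinable : Series.Joinable chains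
  series-chains-joinable a b = inj₁ (series-below a b) , inj₂ (series-below a b)

  parallel-antichains-joinable : Parallel.Joinable antichains
  parallel-antichains-joinable a b =
      (λ e → ⊥-elim (true≢false (trans (sym e) (proj₁ (parallel-apart a b)))))
    , (λ e → ⊥-elim (true≢false (trans (sym e) (proj₂ (parallel-apart a b)))))

  parallel-chains-separated : Parallel.Separated chains
  parallel-chains-separated a b (comparable , _) with comparable
  ... | inj₁ e = true≢false (trans (sym e) (proj₁ (parallel-apart a b)))
  ... | inj₂ e = true≢false (trans (sym e) (proj₂ (parallel-apart a b)))

lemma9 : (P P′ : FinPoset) →
    (DDecomposable (le P) → DDecomposable (le P′) →
      DDecomposable (series P P′) × DDecomposable (parallel P P′))
    × (CDecomposable (le P) → CDecomposable (le P′) →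
      CDecomposable (series P P′) × CDecomposable (parallel P P′))
lemma9 P Q =
    (λ dP dQ → Series.merge-decomposable P Q antichains chains
                 (series-antichains-separated P Q) (series-chains-joinable P Q) dP dQ
             , Parallel.union-decomposable P Q antichains chains
                 (parallel-antichains-joinable P Q) (parallel-chains-separated P Q) dP dQ)
  , (λ cP cQ → Series.union-decomposable P Q chains antichains
                 (series-chains-joinable P Q) (series-antichains-separated P Q) cP cQ
             , Parallel.merge-decomposable P Q chains antichains
                 (parallel-chains-separated P Q) (parallel-antichains-joinable P Q) cP cQ)
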